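{- Let $a,b\in\mathbb Z$ and let $m\in\{2,4,6,7,14\}\cup\{3^j : j\ge 1\}$ with $\gcd(m, b^2-ab-a^2)=1$. Let $w_0=a$, $w_1=b$, $w_n=w_{n-1}+w_{n-2}$. Then the sequence $(w_n)$ modulo $m$ is residue complete, i.e. every residue class modulo $m$ occurs among the $w_n \bmod m$.
   Context: For fixed integers $a,b$, $w_n=w_n(a,b)$ is defined by $w_0=a$, $w_1=b$, $w_n=w_{n-1}+w_{n-2}$; modulo $m$ it is periodic, and a period is denoted $w(a,b,m)$ (a Fibonacci cycle modulo $m$). It is residue complete if every $x\in\mathbb Z_m$ occurs in it. -}

module Defs where

open import Data.Nat as ℕ using (ℕ; zero; suc; _≥_)
open import Data.Integer using (ℤ; +_; _+_; _-_; _*_)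
open import Data.Integer.Divisibility using (_∣_)
open import Data.Integer.GCD using (gcd)
open import Data.Fin using (Fin; toℕ)
open import Data.Product using (∃; Σ; _×_)
open import Data.Sum using (_⊎_)
open import Relation.Binary.PropositionalEquality using (_≡_)

w : ℤ → ℤ → ℕ → ℤ
w a b zero = a
w a b (suc zero) = b
w a b (suc (suc n)) = w a b (suc n) + w a b n

AdmissibleModulus : ℕ → Set
AdmissibleModulus m =
  m ≡ 2 ⊎ m ≡ 4 ⊎ m ≡ 6 ⊎ m ≡ 7 ⊎ m ≡ 14 ⊎ Σ ℕ (λ j → j ≥ 1 × m ≡ 3 ℕ.^ j)

ResidueComplete : ℤ → ℤ → ℕ → Set
ResidueComplete a b m = (r : Fin m) → ∃ λ n → (+ m) ∣ (w a b n - + toℕ r)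

-- Only the residues of a and b modulo m matter, both for the sequence and for the coprimality
-- hypothesis, so for m ∈ {2, 4, 6, 7, 14} the claim is a finite check: for every admissible residue
-- pair the first few terms of the reduced sequence already meet every residue class.
--
-- For m = 3^(i+1) we induct on i. With φ² = φ + 1 we have φ^N = fib₋₁ N + fib N · φ, and cubing shows
-- that for N = 8·3^i, φ^N ≡ 1 + 3^(i+1) φ² modulo 3^(i+2) (the case i = 0 is F₇ = 13, F₈ = 21). Hence
-- w(n + N) ≡ w(n) + 3^(i+1) w(n+2) modulo 3^(i+2), while w(n+2) mod 3 does not change. So if
-- w(n) ≡ r mod 3^(i+1) and w(n+2) is a unit mod 3, then one of the indices n, n + N, n + 2N has
-- w ≡ r mod 3^(i+2), and it inherits the unit. The base case modulo 3 is once more a finite check.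

module Submission where

open import Defs
open import Data.Nat as ℕ using (ℕ; zero; suc)
import Data.Nat.Properties as ℕ
import Data.Nat.Divisibility as ℕ
import Data.Nat.Coprimality as ℕ
open import Data.Integer using (ℤ; +_; -_; _+_; _-_; _*_; _^_; _%ℕ_; _/ℕ_)
open import Data.Integer.Properties
  using (+-injective; +-comm; pos-*; +-inverseʳ; +-identityʳ; *-comm; *-zeroʳ)
open import Data.Integer.DivMod using (n%ℕd<d; a≡a%ℕn+[a/ℕn]*n)
open import Data.Integer.Divisibility.Signed
  using (_∣_; divides; ∣ᵤ⇒∣; ∣⇒∣ᵤ; ∣-trans; ∣m∣n⇒∣m+n; ∣m⇒∣-m; ∣n⇒∣m*n; ∣m⇒∣m*n)
open import Data.Integer.Coprimality using (Coprime; coprime?)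
open import Data.Integer.GCD using (gcd)
open import Data.Integer.Tactic.RingSolver using (solve-∀)
open import Data.Fin using (Fin; toℕ; fromℕ<)
open import Data.Fin.Properties using (all?; any?; toℕ-fromℕ<)
open import Data.Product using (∃; _×_; _,_; proj₁; proj₂)
open import Data.Sum using (inj₁; inj₂)
open import Data.Empty using (⊥-elim)
open import Function using (_∘_)
open import Level using (0ℓ)
open import Relation.Binary.Bundles using (Setoid)
import Relation.Binary.Reasoning.Setoid as SetoidReasoning
open import Relation.Nullary using (Dec; ¬_; ¬?)
open import Relation.Nullary.Decidable using (map′; _→-dec_; _×-dec_; from-yes)
open import Relation.Binary.PropositionalEquality

-- Congruences of integers

infix 4 _≡_mod_

record _≡_mod_ (x y m : ℤ) : Set where
  constructor ≡mod
  field ∣-diff : m ∣ x - y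

module _ {m : ℤ} where

  mod-reflexive : ∀ {x y} → x ≡ y → x ≡ y mod m
  mod-reflexive {x} refl = ≡mod (divides (+ 0) (+-inverseʳ x))

  mod-refl : ∀ {x} → x ≡ x mod m
  mod-refl = mod-reflexive refl

  mod-sym : ∀ {x y} → x ≡ y mod m → y ≡ x mod m
  mod-sym {x} {y} (≡mod m∣x-y) = ≡mod (subst (m ∣_) (negate x y) (∣m⇒∣-m m∣x-y))
    where
    negate : ∀ x y → - (x - y) ≡ y - x
    negate = solve-∀

  mod-trans : ∀ {x y z} → x ≡ y mod m → y ≡ z mod m → x ≡ z mod m
  mod-trans {x} {y} {z} (≡mod m∣x-y) (≡mod m∣y-z) =
    ≡mod (subst (m ∣_) (telescope x y z) (∣m∣n⇒∣m+n m∣x-y m∣y-z))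
    where
    telescope : ∀ x y z → (x - y) + (y - z) ≡ x - z
    telescope = solve-∀

  mod-+ : ∀ {x y u v} → x ≡ y mod m → u ≡ v mod m → x + u ≡ y + v mod m
  mod-+ {x} {y} {u} {v} (≡mod m∣x-y) (≡mod m∣u-v) =
    ≡mod (subst (m ∣_) (regroup x y u v) (∣m∣n⇒∣m+n m∣x-y m∣u-v))
    where
    regroup : ∀ x y u v → (x - y) + (u - v) ≡ (x + u) - (y + v)
    regroup = solve-∀

  mod-sub : ∀ {x y u v} → x ≡ y mod m → u ≡ v mod m → x - u ≡ y - v mod m
  mod-sub {x} {y} {u} {v} (≡mod m∣x-y) (≡mod m∣u-v) =
    ≡mod (subst (m ∣_) (regroup x y u v) (∣m∣n⇒∣m+n m∣x-y (∣m⇒∣-m m∣u-v)))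
    where
    regroup : ∀ x y u v → (x - y) + - (u - v) ≡ (x - u) - (y - v)
    regroup = solve-∀

  mod-* : ∀ {x y u v} → x ≡ y mod m → u ≡ v mod m → x * u ≡ y * v mod m
  mod-* {x} {y} {u} {v} (≡mod m∣x-y) (≡mod m∣u-v) =
    ≡mod (subst (m ∣_) (regroup x y u v) (∣m∣n⇒∣m+n (∣n⇒∣m*n x m∣u-v) (∣m⇒∣m*n v m∣x-y)))
    where
    regroup : ∀ x y u v → x * (u - v) + (x - y) * v ≡ x * u - y * v
    regroup = solve-∀

  ≡+multiple : ∀ {x y} k → x ≡ y + k * m → x ≡ y mod m
  ≡+multiple {y = y} k refl = ≡mod (divides k (cancel y k m))
    where
    cancel : ∀ y k m → (y + k * m) - y ≡ k * m
    cancel = solve-∀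

  ∣-resp-mod : ∀ {x y} → x ≡ y mod m → m ∣ x → m ∣ y
  ∣-resp-mod {x} {y} (≡mod m∣x-y) m∣x = subst (m ∣_) (cancel x y) (∣m∣n⇒∣m+n m∣x (∣m⇒∣-m m∣x-y))
    where
    cancel : ∀ x y → x + - (x - y) ≡ y
    cancel = solve-∀

mod-scale : ∀ {m x y} k → x ≡ y mod m → k * x ≡ k * y mod m * k
mod-scale {m} {x} {y} k (≡mod (divides q x-y≡qm)) = ≡mod (divides q (begin
  k * x - k * y ≡⟨ distrib k x y ⟩
  k * (x - y)   ≡⟨ cong (k *_) x-y≡qm ⟩
  k * (q * m)   ≡⟨ reassoc k q m ⟩
  q * (m * k)   ∎))
  where
  open ≡-Reasoning
  distrib : ∀ k x y → k * x - k * y ≡ k * (x - y)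
  distrib = solve-∀
  reassoc : ∀ k q m → k * (q * m) ≡ q * (m * k)
  reassoc = solve-∀

mod-weaken : ∀ {d m x y} → d ∣ m → x ≡ y mod m → x ≡ y mod d
mod-weaken d∣m (≡mod m∣x-y) = ≡mod (∣-trans d∣m m∣x-y)

mod-setoid : ℤ → Setoid 0ℓ 0ℓ
mod-setoid m = record
  { Carrier = ℤ
  ; _≈_ = λ x y → x ≡ y mod m
  ; isEquivalence = record { refl = mod-refl ; sym = mod-sym ; trans = mod-trans }
  }

module ModReasoning (m : ℤ) = SetoidReasoning (mod-setoid m)

≡%ℕ : ∀ x m .{{_ : ℕ.NonZero m}} → x ≡ + (x %ℕ m) mod + m
≡%ℕ x m = ≡+multiple (x /ℕ m) (a≡a%ℕn+[a/ℕn]*n x m)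

-- Generalised Fibonacci sequences

fib₋₁ fib : ℕ → ℤ
fib₋₁ = w (+ 1) (+ 0)
fib = w (+ 0) (+ 1)

w-suc : ∀ a b n → w a b (suc n) ≡ w b (a + b) n
w-suc a b zero = refl
w-suc a b (suc zero) = +-comm b a
w-suc a b (suc (suc n)) = cong₂ _+_ (w-suc a b (suc n)) (w-suc a b n)

w-linear : ∀ a b n → w a b n ≡ a * fib₋₁ n + b * fib n
w-linear a b zero = unit a b
  where
  unit : ∀ a b → a ≡ a * + 1 + b * + 0
  unit = solve-∀
w-linear a b (suc zero) = unit a b
  where
  unit : ∀ a b → b ≡ a * + 0 + b * + 1
  unit = solve-∀
w-linear a b (suc (suc n)) =
  trans (cong₂ _+_ (w-linear a b (suc n)) (w-linear a b n)) (collect a b _ _ _ _)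
  where
  collect : ∀ a b g₁ f₁ g₀ f₀ →
            (a * g₁ + b * f₁) + (a * g₀ + b * f₀) ≡ a * (g₁ + g₀) + b * (f₁ + f₀)
  collect = solve-∀

w-+ : ∀ a b n k → w a b (n ℕ.+ k) ≡ w a b n * fib₋₁ k + w a b (suc n) * fib k
w-+ a b zero k = w-linear a b k
w-+ a b (suc n) k = begin
  w a b (suc n ℕ.+ k)                                ≡⟨ w-suc a b (n ℕ.+ k) ⟩
  w b (a + b) (n ℕ.+ k)                              ≡⟨ w-+ b (a + b) n k ⟩
  w b (a + b) n * fib₋₁ k + w b (a + b) (suc n) * fib k
    ≡⟨ sym (cong₂ (λ x y → x * fib₋₁ k + y * fib k) (w-suc a b n) (w-suc a b (suc n))) ⟩
  w a b (suc n) * fib₋₁ k + w a b (suc (suc n)) * fib k ∎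
  where open ≡-Reasoning

fib₋₁-+ : ∀ n k → fib₋₁ (n ℕ.+ k) ≡ fib₋₁ n * fib₋₁ k + fib n * fib k
fib₋₁-+ n k = trans (w-+ (+ 1) (+ 0) n k) (cong (λ x → fib₋₁ n * fib₋₁ k + x * fib k) (w-suc (+ 1) (+ 0) n))

fib-+ : ∀ n k → fib (n ℕ.+ k) ≡ fib n * fib₋₁ k + (fib₋₁ n + fib n) * fib k
fib-+ n k = trans (w-+ (+ 0) (+ 1) n k) (cong (λ x → fib n * fib₋₁ k + x * fib k) fib-suc)
  where
  fib-suc : fib (suc n) ≡ fib₋₁ n + fib n
  fib-suc = trans (w-suc (+ 0) (+ 1) n) (trans (w-linear (+ 1) (+ 1) n) (ones (fib₋₁ n) (fib n)))
    where
    ones : ∀ x y → + 1 * x + + 1 * y ≡ x + y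
    ones = solve-∀

-- (x + y φ)³ = cube₀ x y + cube₁ x y φ  when  φ² = φ + 1.
cube₀ cube₁ : ℤ → ℤ → ℤ
cube₀ x y = x * x * x + + 3 * x * y * y + y * y * y
cube₁ x y = + 3 * x * x * y + + 3 * x * y * y + + 2 * y * y * y

fib-triple : ∀ N → fib₋₁ (3 ℕ.* N) ≡ cube₀ (fib₋₁ N) (fib N) × fib (3 ℕ.* N) ≡ cube₁ (fib₋₁ N) (fib N)
fib-triple N rewrite ℕ.+-identityʳ N =
    trans (fib₋₁-+ N (N ℕ.+ N)) (trans (cong₂ (λ g f → x * g + y * f) (fib₋₁-+ N N) (fib-+ N N)) (expand₀ x y))
  , trans (fib-+ N (N ℕ.+ N)) (trans (cong₂ (λ g f → y * g + (x + y) * f) (fib₋₁-+ N N) (fib-+ N N)) (expand₁ x y))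
  where
  x y : ℤ
  x = fib₋₁ N
  y = fib N
  expand₀ : ∀ x y → x * (x * x + y * y) + y * (y * x + (x + y) * y) ≡ x * x * x + + 3 * x * y * y + y * y * y
  expand₀ = solve-∀
  expand₁ : ∀ x y → y * (x * x + y * y) + (x + y) * (y * x + (x + y) * y)
                    ≡ + 3 * x * x * y + + 3 * x * y * y + + 2 * y * y * y
  expand₁ = solve-∀

w-cong : ∀ {m a a′ b b′} → a ≡ a′ mod m → b ≡ b′ mod m → ∀ n → w a b n ≡ w a′ b′ n mod m
w-cong a≡a′ b≡b′ zero = a≡a′
w-cong a≡a′ b≡b′ (suc zero) = b≡b′
w-cong a≡a′ b≡b′ (suc (suc n)) = mod-+ (w-cong a≡a′ b≡b′ (suc n)) (w-cong a≡a′ b≡b′ n)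

-- Finite moduli, by exhaustive search

disc : ℤ → ℤ → ℤ
disc a b = b * b - a * b - a * a

disc-cong : ∀ {m a a′ b b′} → a ≡ a′ mod m → b ≡ b′ mod m → disc a b ≡ disc a′ b′ mod m
disc-cong a≡a′ b≡b′ = mod-sub (mod-sub (mod-* b≡b′ b≡b′) (mod-* a≡a′ b≡b′)) (mod-* a≡a′ a≡a′)

gcd≡1⇒coprime : ∀ i j → gcd i j ≡ + 1 → Coprime i j
gcd≡1⇒coprime i j = ℕ.gcd≡1⇒coprime ∘ +-injective

coprime-resp-mod : ∀ {m x y} → Coprime (+ m) x → x ≡ y mod + m → Coprime (+ m) y
coprime-resp-mod {m} {x} {y} cop x≡y {d} (d∣m , d∣y) =
  cop (d∣m , ∣⇒∣ᵤ (∣-resp-mod (mod-sym (mod-weaken (∣ᵤ⇒∣ d∣m) x≡y)) (∣ᵤ⇒∣ {+ d} {y} d∣y)))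

coprime-∣ˡ : ∀ {d m x} → d ℕ.∣ m → Coprime (+ m) x → Coprime (+ d) x
coprime-∣ˡ d∣m cop (e∣d , e∣x) = cop (ℕ.∣-trans e∣d d∣m , e∣x)

wMod : (m : ℕ) .{{_ : ℕ.NonZero m}} → ℕ → ℕ → ℕ → ℕ
wMod m x y zero = x
wMod m x y (suc n) = wMod m y ((x ℕ.+ y) ℕ.% m) n

w≡wMod : ∀ m .{{_ : ℕ.NonZero m}} x y n → w (+ x) (+ y) n ≡ + wMod m x y n mod + m
w≡wMod m x y zero = mod-refl
w≡wMod m x y (suc n) = begin
  w (+ x) (+ y) (suc n)            ≡⟨ w-suc (+ x) (+ y) n ⟩
  w (+ y) (+ (x ℕ.+ y)) n          ≈⟨ w-cong mod-refl (≡%ℕ (+ (x ℕ.+ y)) m) n ⟩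
  w (+ y) (+ ((x ℕ.+ y) ℕ.% m)) n  ≈⟨ w≡wMod m y _ n ⟩
  + wMod m x y (suc n)             ∎
  where open ModReasoning (+ m)

residue : ∀ m .{{_ : ℕ.NonZero m}} → ℤ → Fin m
residue m x = fromℕ< (n%ℕd<d x m)

≡residue : ∀ m .{{_ : ℕ.NonZero m}} x → x ≡ + toℕ (residue m x) mod + m
≡residue m x rewrite toℕ-fromℕ< (n%ℕd<d x m) = ≡%ℕ x m

wModOf : ∀ m .{{_ : ℕ.NonZero m}} → ℤ → ℤ → ℕ → ℕ
wModOf m a b = wMod m (toℕ (residue m a)) (toℕ (residue m b))

w≡wModOf : ∀ m .{{_ : ℕ.NonZero m}} a b n → w a b n ≡ + wModOf m a b n mod + m
w≡wModOf m a b n = mod-trans (w-cong (≡residue m a) (≡residue m b) n) (w≡wMod m _ _ n)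

-- Hit s r n: index n of the reduced sequence s witnesses the residue r.
record Table (m B : ℕ) .{{_ : ℕ.NonZero m}} (Hit : (ℕ → ℕ) → ℕ → ℕ → Set) : Set where
  constructor mkTable
  field
    hit : (x y : Fin m) → Coprime (+ m) (disc (+ toℕ x) (+ toℕ y)) →
          (r : Fin m) → ∃ λ (n : Fin B) → Hit (wMod m (toℕ x) (toℕ y)) (toℕ r) (toℕ n)

table? : ∀ m B .{{_ : ℕ.NonZero m}} {Hit} → (∀ s r n → Dec (Hit s r n)) → Dec (Table m B Hit)
table? m B hit? = map′ mkTable Table.hit (
  all? λ x → all? λ y → coprime? (+ m) (disc (+ toℕ x) (+ toℕ y)) →-dec
  all? λ r → any? λ n → hit? (wMod m (toℕ x) (toℕ y)) (toℕ r) (toℕ n))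

table-sound : ∀ {m B Hit} .{{_ : ℕ.NonZero m}} → Table m B Hit →
  ∀ a b → Coprime (+ m) (disc a b) → (r : Fin m) → ∃ λ n → Hit (wModOf m a b) (toℕ r) n
table-sound {m} (mkTable hits) a b cop r =
  let n , hit = hits (residue m a) (residue m b) cop′ r in toℕ n , hit
  where
  cop′ : Coprime (+ m) (disc (+ toℕ (residue m a)) (+ toℕ (residue m b)))
  cop′ = coprime-resp-mod cop (disc-cong (≡residue m a) (≡residue m b))

Hits : (ℕ → ℕ) → ℕ → ℕ → Set
Hits s r n = s n ≡ r

residueComplete-table : ∀ {m B} .{{_ : ℕ.NonZero m}} → Table m B Hits →
  ∀ a b → Coprime (+ m) (disc a b) → ResidueComplete a b m
residueComplete-table {m} table a b cop r =
  let n , hit = table-sound table a b cop r in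
  n , ∣⇒∣ᵤ (_≡_mod_.∣-diff (mod-trans (w≡wModOf m a b n) (mod-reflexive (cong +_ hit))))

table₂ : Table 2 3 Hits
table₂ = from-yes (table? 2 3 λ s r n → s n ℕ.≟ r)
table₄ : Table 4 6 Hits
table₄ = from-yes (table? 4 6 λ s r n → s n ℕ.≟ r)
table₆ : Table 6 24 Hits
table₆ = from-yes (table? 6 24 λ s r n → s n ℕ.≟ r)
table₇ : Table 7 16 Hits
table₇ = from-yes (table? 7 16 λ s r n → s n ℕ.≟ r)
table₁₄ : Table 14 48 Hits
table₁₄ = from-yes (table? 14 48 λ s r n → s n ℕ.≟ r)

-- Powers of 3

-- φ^N ≡ 1 + T φ² modulo 3T, in the coordinates φ^N = fib₋₁ N + fib N · φ.
record PeriodLift (T : ℤ) (N : ℕ) : Set where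
  constructor periodLift⟨_,_,_,_,_,_⟩
  field
    u v : ℤ
    fib₋₁N≡ : fib₋₁ N ≡ + 1 + T * u
    fibN≡ : fib N ≡ T * v
    u≡1 : u ≡ + 1 mod + 3
    v≡1 : v ≡ + 1 mod + 3

periodLift-triple : ∀ S N → PeriodLift (+ 3 * S) N → PeriodLift (+ 3 * (+ 3 * S)) (3 ℕ.* N)
periodLift-triple S N periodLift⟨ u , v , fib₋₁N≡ , fibN≡ , u≡1 , v≡1 ⟩ =
  periodLift⟨ u + U * + 3 , v + V * + 3
            , trans (proj₁ (fib-triple N)) (trans (cong₂ cube₀ fib₋₁N≡ fibN≡) (cube₀-near-1 S u v))
            , trans (proj₂ (fib-triple N)) (trans (cong₂ cube₁ fib₋₁N≡ fibN≡) (cube₁-near-1 S u v))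
            , mod-trans (≡+multiple U refl) u≡1
            , mod-trans (≡+multiple V refl) v≡1 ⟩
  where
  U V : ℤ
  U = S * (u * u + v * v) + S * S * (u * u * u + + 3 * u * v * v + v * v * v)
  V = S * (+ 2 * u * v + v * v) + S * S * (+ 3 * u * u * v + + 3 * u * v * v + + 2 * v * v * v)
  cube₀-near-1 : ∀ S u v → let x = + 1 + + 3 * S * u ; y = + 3 * S * v in
    x * x * x + + 3 * x * y * y + y * y * y ≡
    + 1 + + 3 * (+ 3 * S) * (u + (S * (u * u + v * v) + S * S * (u * u * u + + 3 * u * v * v + v * v * v)) * + 3)
  cube₀-near-1 = solve-∀
  cube₁-near-1 : ∀ S u v → let x = + 1 + + 3 * S * u ; y = + 3 * S * v in
    + 3 * x * x * y + + 3 * x * y * y + + 2 * y * y * y ≡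
    + 3 * (+ 3 * S) * (v + (S * (+ 2 * u * v + v * v) + S * S * (+ 3 * u * u * v + + 3 * u * v * v + + 2 * v * v * v)) * + 3)
  cube₁-near-1 = solve-∀

periodLift : ∀ i → PeriodLift ((+ 3) ^ suc i) (3 ℕ.^ i ℕ.* 8)
periodLift zero = periodLift⟨ + 4 , + 7 , refl , refl , ≡mod (divides (+ 1) refl) , ≡mod (divides (+ 2) refl) ⟩
periodLift (suc i) =
  subst (PeriodLift ((+ 3) ^ suc (suc i))) (sym (ℕ.*-assoc 3 (3 ℕ.^ i) 8))
        (periodLift-triple ((+ 3) ^ i) (3 ℕ.^ i ℕ.* 8) (periodLift i))

w-shift : ∀ {T N} → PeriodLift T N → ∀ a b n →
          w a b (n ℕ.+ N) ≡ w a b n + T * w a b (2 ℕ.+ n) mod + 3 * T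
w-shift {T} {N} periodLift⟨ u , v , fib₋₁N≡ , fibN≡ , u≡1 , v≡1 ⟩ a b n = begin
  w a b (n ℕ.+ N)                  ≡⟨ w-+ a b n N ⟩
  x * fib₋₁ N + y * fib N          ≡⟨ cong₂ (λ g f → x * g + y * f) fib₋₁N≡ fibN≡ ⟩
  x * (+ 1 + T * u) + y * (T * v)  ≡⟨ expand x y T u v ⟩
  x + T * (u * x + v * y)          ≈⟨ mod-+ (mod-refl {x = x}) (mod-scale T u*x+v*y≡y+x) ⟩
  x + T * (y + x)                  ∎
  where
  open ModReasoning (+ 3 * T)
  x y : ℤ
  x = w a b n
  y = w a b (suc n)
  expand : ∀ x y T u v → x * (+ 1 + T * u) + y * (T * v) ≡ x + T * (u * x + v * y)
  expand = solve-∀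
  ones : ∀ x y → + 1 * x + + 1 * y ≡ y + x
  ones = solve-∀
  u*x+v*y≡y+x : u * x + v * y ≡ y + x mod + 3
  u*x+v*y≡y+x = mod-trans (mod-+ (mod-* u≡1 mod-refl) (mod-* v≡1 mod-refl)) (mod-reflexive (ones x y))

w-shift-mod3 : ∀ S {N} → PeriodLift (+ 3 * S) N → ∀ a b n → w a b (n ℕ.+ N) ≡ w a b n mod + 3
w-shift-mod3 S period a b n =
  mod-trans (mod-weaken (divides (+ 3 * S) (*-comm (+ 3) (+ 3 * S))) (w-shift period a b n))
            (≡+multiple (S * w a b (2 ℕ.+ n)) (reassoc (w a b n) S (w a b (2 ℕ.+ n))))
  where
  reassoc : ∀ x S c → x + + 3 * S * c ≡ x + S * c * + 3
  reassoc = solve-∀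

w-shift-iterate-mod3 : ∀ S {N} → PeriodLift (+ 3 * S) N → ∀ a b j n →
                       w a b (n ℕ.+ j ℕ.* N) ≡ w a b n mod + 3
w-shift-iterate-mod3 S period a b zero n = mod-reflexive (cong (w a b) (ℕ.+-identityʳ n))
w-shift-iterate-mod3 S {N} period a b (suc j) n =
  mod-trans (mod-reflexive (cong (w a b) (sym (ℕ.+-assoc n N (j ℕ.* N)))))
    (mod-trans (w-shift-iterate-mod3 S period a b j (n ℕ.+ N)) (w-shift-mod3 S period a b n))

w-shift-iterate : ∀ S {N} → PeriodLift (+ 3 * S) N → ∀ a b j n →
  w a b (n ℕ.+ j ℕ.* N) ≡ w a b n + + j * (+ 3 * S * w a b (2 ℕ.+ n)) mod + 3 * (+ 3 * S)
w-shift-iterate S period a b zero n =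
  mod-reflexive (trans (cong (w a b) (ℕ.+-identityʳ n)) (sym (+-identityʳ (w a b n))))
w-shift-iterate S {N} period a b (suc j) n = begin
  w a b (n ℕ.+ suc j ℕ.* N)                   ≡⟨ cong (w a b) (sym (ℕ.+-assoc n N (j ℕ.* N))) ⟩
  w a b (n ℕ.+ N ℕ.+ j ℕ.* N)                 ≈⟨ w-shift-iterate S period a b j (n ℕ.+ N) ⟩
  w a b (n ℕ.+ N) + + j * (T * w a b (2 ℕ.+ n ℕ.+ N))
    ≈⟨ mod-+ (w-shift period a b n) (mod-* (mod-refl {x = + j}) (mod-scale T (w-shift-mod3 S period a b (2 ℕ.+ n)))) ⟩
  w a b n + T * c + + j * (T * c)             ≡⟨ collect (w a b n) (T * c) (+ j) ⟩
  w a b n + + suc j * (T * c)                 ∎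
  where
  open ModReasoning (+ 3 * (+ 3 * S))
  T c : ℤ
  T = + 3 * S
  c = w a b (2 ℕ.+ n)
  collect : ∀ x d j → x + d + j * d ≡ x + (+ 1 + j) * d
  collect = solve-∀

square-unit-mod3 : ∀ c → ¬ + 3 ∣ c → c * c ≡ + 1 mod + 3
square-unit-mod3 c 3∤c with c %ℕ 3 | ≡%ℕ c 3 | n%ℕd<d c 3
... | 0 | c≡0 | _ = ⊥-elim (3∤c (∣-resp-mod (mod-sym c≡0) (divides (+ 0) refl)))
... | 1 | c≡1 | _ = mod-* c≡1 c≡1
... | 2 | c≡2 | _ = mod-trans (mod-* c≡2 c≡2) (≡mod (divides (+ 1) refl))
... | suc (suc (suc _)) | _ | ℕ.s≤s (ℕ.s≤s (ℕ.s≤s ()))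

lift-hit : ∀ S {N} → PeriodLift (+ 3 * S) N → ∀ {a b r n} →
           w a b n ≡ r mod + 3 * S → ¬ + 3 ∣ w a b (2 ℕ.+ n) →
           ∃ λ n′ → w a b n′ ≡ r mod + 3 * (+ 3 * S) × ¬ + 3 ∣ w a b (2 ℕ.+ n′)
lift-hit S {N} period {a} {b} {r} {n} (≡mod (divides k wn-r≡kT)) 3∤c =
  n ℕ.+ j ℕ.* N , hits-r , 3∤c ∘ ∣-resp-mod (w-shift-iterate-mod3 S period a b j (2 ℕ.+ n))
  where
  T c : ℤ
  T = + 3 * S
  c = w a b (2 ℕ.+ n)
  j : ℕ
  j = (- k * c) %ℕ 3
  next-digit-vanishes : k + + j * c ≡ + 0 mod + 3
  next-digit-vanishes = begin
    k + + j * c        ≈⟨ mod-+ (mod-refl {x = k}) (mod-* (mod-sym (≡%ℕ (- k * c) 3)) (mod-refl {x = c})) ⟩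
    k + - k * c * c    ≡⟨ factor k c ⟩
    k * (+ 1 - c * c)  ≈⟨ mod-* (mod-refl {x = k}) (mod-sub (mod-refl {x = + 1}) (square-unit-mod3 c 3∤c)) ⟩
    k * (+ 1 - + 1)    ≡⟨ *-zeroʳ k ⟩
    + 0                ∎
    where
    open ModReasoning (+ 3)
    factor : ∀ k c → k + - k * c * c ≡ k * (+ 1 - c * c)
    factor = solve-∀
  hits-r : w a b (n ℕ.+ j ℕ.* N) ≡ r mod + 3 * T
  hits-r = begin
    w a b (n ℕ.+ j ℕ.* N)        ≈⟨ w-shift-iterate S period a b j n ⟩
    w a b n + + j * (T * c)      ≡⟨ split (w a b n) r (+ j * (T * c)) ⟩
    r + ((w a b n - r) + + j * (T * c)) ≡⟨ cong (λ d → r + (d + + j * (T * c))) wn-r≡kT ⟩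
    r + (k * T + + j * (T * c))  ≡⟨ cong (_+_ r) (factor k (+ j) c T) ⟩
    r + T * (k + + j * c)        ≈⟨ mod-+ (mod-refl {x = r}) (mod-scale T next-digit-vanishes) ⟩
    r + T * + 0                  ≡⟨ vanish r T ⟩
    r                            ∎
    where
    open ModReasoning (+ 3 * T)
    split : ∀ x r d → x + d ≡ r + ((x - r) + d)
    split = solve-∀
    factor : ∀ k j c T → k * T + j * (T * c) ≡ T * (k + j * c)
    factor = solve-∀
    vanish : ∀ r T → r + T * + 0 ≡ r
    vanish = solve-∀

CompleteWithUnit : ℕ → ℤ → ℤ → Set
CompleteWithUnit i a b = ∀ r → ∃ λ n → w a b n ≡ r mod (+ 3) ^ suc i × ¬ + 3 ∣ w a b (2 ℕ.+ n)

HitsWithUnit : (ℕ → ℕ) → ℕ → ℕ → Set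
HitsWithUnit s r n = s n ≡ r × ¬ 3 ℕ.∣ s (2 ℕ.+ n)

table₃ : Table 3 8 HitsWithUnit
table₃ = from-yes (table? 3 8 λ s r n → (s n ℕ.≟ r) ×-dec ¬? (3 ℕ.∣? s (2 ℕ.+ n)))

completeWithUnit : ∀ a b → Coprime (+ 3) (disc a b) → ∀ i → CompleteWithUnit i a b
completeWithUnit a b cop zero r =
  let n , hit , 3∤s = table-sound table₃ a b cop (residue 3 r) in
  n , mod-trans (w≡wModOf 3 a b n) (mod-trans (mod-reflexive (cong +_ hit)) (mod-sym (≡residue 3 r)))
    , 3∤s ∘ ∣⇒∣ᵤ ∘ ∣-resp-mod (w≡wModOf 3 a b (2 ℕ.+ n))
completeWithUnit a b cop (suc i) r =
  let n , hit , unit = completeWithUnit a b cop i r in lift-hit ((+ 3) ^ i) (periodLift i) {n = n} hit unit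

pos-^ : ∀ k n → + (k ℕ.^ n) ≡ (+ k) ^ n
pos-^ k zero = refl
pos-^ k (suc n) = trans (pos-* k (k ℕ.^ n)) (cong (+ k *_) (pos-^ k n))

residueComplete-3^ : ∀ i a b → Coprime (+ 3) (disc a b) → ResidueComplete a b (3 ℕ.^ suc i)
residueComplete-3^ i a b cop r =
  let n , hit , _ = completeWithUnit a b cop i (+ toℕ r) in
  n , ∣⇒∣ᵤ (subst (_∣ w a b n - + toℕ r) (sym (pos-^ 3 (suc i))) (_≡_mod_.∣-diff hit))

lemma2p2 : (a b : ℤ) (m : ℕ) → AdmissibleModulus m →
           gcd (+ m) (b * b - a * b - a * a) ≡ + 1 →
           ResidueComplete a b m
lemma2p2 a b m admissible gcd≡1 with gcd≡1⇒coprime (+ m) (disc a b) gcd≡1 | admissible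
... | cop | inj₁ refl = residueComplete-table table₂ a b cop
... | cop | inj₂ (inj₁ refl) = residueComplete-table table₄ a b cop
... | cop | inj₂ (inj₂ (inj₁ refl)) = residueComplete-table table₆ a b cop
... | cop | inj₂ (inj₂ (inj₂ (inj₁ refl))) = residueComplete-table table₇ a b cop
... | cop | inj₂ (inj₂ (inj₂ (inj₂ (inj₁ refl)))) = residueComplete-table table₁₄ a b cop
... | cop | inj₂ (inj₂ (inj₂ (inj₂ (inj₂ (suc i , _ , refl))))) =
  residueComplete-3^ i a b (coprime-∣ˡ {m = 3 ℕ.^ suc i} {disc a b} (ℕ.m∣m*n (3 ℕ.^ i)) cop)
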